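{- Let $G$ be a $\{K_{1,4},K_{1,4}+e\}$-free split graph with a split partition $(S,I)$. Then $G$ does not have a subgraph $H$ such that $|V(H)\cap S|=2$ and $H$ is isomorphic to the vertex-disjoint union of $K_{1,3}$ and $K_{1,2}$.
   Context: All graphs are finite, simple and connected. A connected graph $G$ is a split graph if its vertex set can be partitioned into a clique and an independent set. A split partition of a split graph $G$ is an ordered pair $(S,I)$ with $V(G)=S\cup I$, $S\cap I=\emptyset$, where $S$ is a maximum clique of $G$ and $I$ is an independent set of $G$. A graph is $\{F_1,\dots,F_k\}$-free if it contains no induced subgraph isomorphic to any $F_i$. $K_{1,r}$ is the star with $r$ leaves, and $K_{1,4}+e$ is the graph obtained from $K_{1,4}$ by adding one edge joining two leaves. -}

module Defs where

import Data.Nat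
open import Data.Nat using (ℕ; zero; suc; _≤_; _≡ᵇ_; _<ᵇ_)
open import Data.Bool using (Bool; true; false; T; _∧_; _∨_; _xor_; not; if_then_else_)
open import Data.Fin using (Fin; toℕ)
import Data.Fin
open import Data.Fin.Subset using (Subset; _∈_; _∉_; ∣_∣)
open import Data.Product using (Σ; _×_)
open import Data.Empty using (⊥)
open import Relation.Nullary using (¬_; Dec)
open import Relation.Binary.PropositionalEquality using (_≡_; _≢_)
open import Function.Definitions using (Injective)

record Graph (n : ℕ) : Set₁ where
  field
    Adj    : Fin n → Fin n → Set
    adj?   : ∀ x y → Dec (Adj x y)
    sym    : ∀ {x y} → Adj x y → Adj y x
    irrefl : ∀ {x} → ¬ Adj x x
open Graph public

data Reachable {n : ℕ} (G : Graph n) : Fin n → Fin n → Set where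
  here : ∀ {x} → Reachable G x x
  step : ∀ {x y z} → Adj G x y → Reachable G y z → Reachable G x z

Connected : ∀ {n} → Graph n → Set
Connected G = ∀ x y → Reachable G x y

IsClique : ∀ {n} → Graph n → Subset n → Set
IsClique G C = ∀ x y → x ∈ C → y ∈ C → x ≢ y → Adj G x y

IsIndependent : ∀ {n} → Graph n → Subset n → Set
IsIndependent G J = ∀ x y → x ∈ J → y ∈ J → ¬ Adj G x y

-- Split partition (S, I): S a maximum clique, I = complement of S independent.
IsSplitPartition : ∀ {n} → Graph n → Subset n → Set
IsSplitPartition G S =
  IsClique G S
  × (∀ C → IsClique G C → ∣ C ∣ ≤ ∣ S ∣)
  × (∀ x y → x ∉ S → y ∉ S → ¬ Adj G x y)

Pattern : ℕ → Set
Pattern k = Fin k → Fin k → Bool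

InducedCopy : ∀ {k n} → Pattern k → Graph n → Set
InducedCopy {k} {n} P G =
  Σ (Fin k → Fin n) λ f → Injective _≡_ _≡_ f
    × (∀ i j → i ≢ j → (T (P i j) → Adj G (f i) (f j)) × (Adj G (f i) (f j) → T (P i j)))

IsSubgraphCopy : ∀ {k n} → Pattern k → Graph n → (Fin k → Fin n) → Set
IsSubgraphCopy {k} P G f =
  Injective _≡_ _≡_ f × (∀ i j → i ≢ j → T (P i j) → Adj G (f i) (f j))

-- K_{1,4} on Fin 5: centre 0, leaves 1..4.
K14 : Pattern 5
K14 i j = (toℕ i ≡ᵇ 0) xor (toℕ j ≡ᵇ 0)

-- K_{1,4}+e: additionally the edge between leaves 1 and 2.
K14+e : Pattern 5
K14+e i j = K14 i j ∨ ((toℕ i ≡ᵇ 1) ∧ (toℕ j ≡ᵇ 2)) ∨ ((toℕ i ≡ᵇ 2) ∧ (toℕ j ≡ᵇ 1))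

-- Disjoint union K_{1,3} + K_{1,2} on Fin 7:
-- K_{1,3} on {0,1,2,3} with centre 0; K_{1,2} on {4,5,6} with centre 4.
K13⊔K12 : Pattern 7
K13⊔K12 i j =
  ((toℕ i <ᵇ 4) ∧ (toℕ j <ᵇ 4) ∧ ((toℕ i ≡ᵇ 0) xor (toℕ j ≡ᵇ 0)))
  ∨ (not (toℕ i <ᵇ 4) ∧ not (toℕ j <ᵇ 4) ∧ ((toℕ i ≡ᵇ 4) xor (toℕ j ≡ᵇ 4)))

count : ∀ {k} → (Fin k → Bool) → ℕ
count {zero}  p = 0
count {suc k} p = (if p Data.Fin.zero then 1 else 0) Data.Nat.+ count (λ i → p (Data.Fin.suc i))

{-# OPTIONS --safe #-}
-- Every edge of a split graph meets the clique S, so two vertices of S can cover the edges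
-- of K₁,₃ ⊔ K₁,₂ only if they are its two centres a and b.  Then a ~ b and the five legs lie
-- in the independent set.  If b is adjacent to two legs of a, those two and b's own legs make
-- b the centre of an induced K₁,₄; if to exactly one, a with b and its three legs is an induced
-- K₁,₄+e; if to none, a with b and its three legs is an induced K₁,₄.
module Submission where

open import Defs
open import Data.Bool using (Bool; true; false; T; if_then_else_)
import Data.Bool.Properties as Bool
open import Data.Empty using (⊥; ⊥-elim)
open import Data.Fin using (Fin; zero; suc; #_; punchIn; punchOut; _≟_)
open import Data.Fin.Properties using (0≢1+n; all?; punchIn-punchOut; punchOut-injective; suc-injective)
open import Data.Fin.Subset using (Subset; _∈_; _∉_)
open import Data.Fin.Subset.Properties using (_∈?_)
open import Data.Nat using (zero; suc; _+_; _≤_; z≤n; s≤s)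
open import Data.Nat.Properties using (+-suc)
open import Data.Product using (Σ; _×_; _,_)
open import Data.Sum using (_⊎_; inj₁; inj₂; [_,_])
open import Data.Unit using (tt)
open import Data.Vec using (lookup)
open import Data.Vec.Properties using ([]=⇒lookup)
open import Data.Vec.Functional using (_∷_; [])
open import Function using (_∘_)
open import Function.Definitions using (Injective)
open import Relation.Nullary using (¬_; Dec; yes; no)
open import Relation.Nullary.Decidable using (True; toWitness; map′; _→-dec_; from-yes; decidable-stable)
open import Relation.Nullary.Reflects using (Reflects; ofʸ; ofⁿ)
open import Relation.Binary.PropositionalEquality as ≡ using (_≡_; _≢_; refl; cong; subst)

count-punchIn : ∀ {k} (p : Fin (suc k) → Bool) {i} → p i ≡ true →
                count p ≡ suc (count (p ∘ punchIn i))
count-punchIn p {zero} pᵢ rewrite pᵢ = refl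
count-punchIn {suc k} p {suc i} pᵢ =
  ≡.trans (cong ((if p zero then 1 else 0) +_) (count-punchIn (p ∘ suc) pᵢ)) (+-suc _ _)

injective⇒≤count : ∀ {m k} (p : Fin k → Bool) (g : Fin m → Fin k) → Injective _≡_ _≡_ g →
                   (∀ i → p (g i) ≡ true) → m ≤ count p
injective⇒≤count {zero}          p g g-inj p∘g = z≤n
injective⇒≤count {suc m} {zero}  p g g-inj p∘g with g zero
... | ()
injective⇒≤count {suc m} {suc k} p g g-inj p∘g =
  subst (suc m ≤_) (≡.sym (count-punchIn p (p∘g zero)))
        (s≤s (injective⇒≤count (p ∘ punchIn (g zero)) g′ g′-inj p∘g′))
  where
  g₀≢ : ∀ i → g zero ≢ g (suc i)
  g₀≢ i = 0≢1+n ∘ g-inj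
  g′ : Fin m → Fin k
  g′ i = punchOut (g₀≢ i)
  g′-inj : Injective _≡_ _≡_ g′
  g′-inj eq = suc-injective (g-inj (punchOut-injective (g₀≢ _) (g₀≢ _) eq))
  p∘g′ : ∀ i → p (punchIn (g zero) (g′ i)) ≡ true
  p∘g′ i = ≡.trans (cong p (punchIn-punchOut (g₀≢ i))) (p∘g (suc i))

injective? : ∀ {m k} (σ : Fin m → Fin k) → Dec (Injective _≡_ _≡_ σ)
injective? σ = map′ (λ inj {x} {y} → inj x y) (λ inj x y → inj)
                    (all? λ x → all? λ y → σ x ≟ σ y →-dec x ≟ y)

decide-injective : ∀ {m k} (σ : Fin m → Fin k) {σ-inj : True (injective? σ)} →
                   Injective _≡_ _≡_ σ
decide-injective σ {σ-inj} = toWitness σ-inj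

injective-∷ : ∀ {k n} {v : Fin n} {w : Fin k → Fin n} →
              (∀ j → v ≢ w j) → Injective _≡_ _≡_ w → Injective _≡_ _≡_ (v ∷ w)
injective-∷ v∉w w-inj {zero}  {zero}  _  = refl
injective-∷ v∉w w-inj {zero}  {suc j} eq = ⊥-elim (v∉w j eq)
injective-∷ v∉w w-inj {suc i} {zero}  eq = ⊥-elim (v∉w i (≡.sym eq))
injective-∷ v∉w w-inj {suc i} {suc j} eq = cong suc (w-inj eq)

edgeless : ∀ {k} → Pattern k
edgeless _ _ = false

extend : ∀ {k} → (Fin k → Bool) → Pattern k → Pattern (suc k)
extend N P zero    zero    = false
extend N P zero    (suc j) = N j
extend N P (suc i) zero    = N i
extend N P (suc i) (suc j) = P i j

cone : ∀ {k} → Pattern k → Pattern (suc k)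
cone = extend (λ _ → true)

K14-as-cone : ∀ i j → cone (extend (λ _ → false) edgeless) i j ≡ K14 i j
K14-as-cone = from-yes (all? λ i → all? λ j →
  cone (extend (λ _ → false) edgeless) i j Bool.≟ K14 i j)

K14+e-as-cone : ∀ i j → cone (extend (true ∷ false ∷ false ∷ []) edgeless) i j ≡ K14+e i j
K14+e-as-cone = from-yes (all? λ i → all? λ j →
  cone (extend (true ∷ false ∷ false ∷ []) edgeless) i j Bool.≟ K14+e i j)

reflects⇒T⇔ : ∀ {A : Set} {b} → Reflects A b → (T b → A) × (A → T b)
reflects⇒T⇔ (ofʸ a)  = (λ _ → a) , (λ _ → tt)
reflects⇒T⇔ (ofⁿ ¬a) = (λ ()) , ⊥-elim ∘ ¬a

module _ {n} (G : Graph n) where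

  Induces : ∀ {k} → Pattern k → (Fin k → Fin n) → Set
  Induces P w = ∀ i j → i ≢ j → Reflects (Adj G (w i) (w j)) (P i j)

  adj⇒≢ : ∀ {x y} → Adj G x y → x ≢ y
  adj⇒≢ {x} x~y refl = irrefl G x~y

  reflects-sym : ∀ {x y b} → Reflects (Adj G x y) b → Reflects (Adj G y x) b
  reflects-sym (ofʸ x~y) = ofʸ (sym G x~y)
  reflects-sym (ofⁿ x≁y) = ofⁿ (x≁y ∘ sym G)

  induced-copy : ∀ {k} {P : Pattern k} (w : Fin k → Fin n) →
                 Injective _≡_ _≡_ w → Induces P w → InducedCopy P G
  induced-copy w w-inj w-induces = w , w-inj , λ i j i≢j → reflects⇒T⇔ (w-induces i j i≢j)

  InducedCopy-≗ : ∀ {k} {P Q : Pattern k} → (∀ i j → P i j ≡ Q i j) →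
                  InducedCopy P G → InducedCopy Q G
  InducedCopy-≗ P≗Q (w , w-inj , w-rel) = w , w-inj , λ i j i≢j →
    subst (λ b → (T b → Adj G (w i) (w j)) × (Adj G (w i) (w j) → T b)) (P≗Q i j) (w-rel i j i≢j)

  induces-edgeless : ∀ {k} {w : Fin k → Fin n} →
                     (∀ i j → ¬ Adj G (w i) (w j)) → Induces edgeless w
  induces-edgeless independent i j _ = ofⁿ (independent i j)

  induces-extend : ∀ {k} {P : Pattern k} {N} {w : Fin (suc k) → Fin n} →
                   Induces P (w ∘ suc) → (∀ j → Reflects (Adj G (w zero) (w (suc j))) (N j)) →
                   Induces (extend N P) w
  induces-extend P-ind N-ref zero    zero    0≢0 = ⊥-elim (0≢0 refl)
  induces-extend P-ind N-ref zero    (suc j) _   = N-ref j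
  induces-extend P-ind N-ref (suc i) zero    _   = reflects-sym (N-ref i)
  induces-extend P-ind N-ref (suc i) (suc j) i≢j = P-ind i j (i≢j ∘ cong suc)

  induced-cone-over-extend :
    ∀ {k} (c : Fin n) (w : Fin (suc k) → Fin n) (N : Fin k → Bool) → Injective _≡_ _≡_ w →
    (∀ i j → ¬ Adj G (w (suc i)) (w (suc j))) →
    (∀ j → Reflects (Adj G (w zero) (w (suc j))) (N j)) →
    (∀ i → Adj G c (w i)) → InducedCopy (cone (extend N edgeless)) G
  induced-cone-over-extend c w N w-inj independent N-ref c~w =
    induced-copy (c ∷ w) (injective-∷ (adj⇒≢ ∘ c~w) w-inj)
      (induces-extend (induces-extend (induces-edgeless independent) N-ref) (ofʸ ∘ c~w))

module Split {n} (G : Graph n) (S : Subset n)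
  (I-independent : ∀ x y → x ∉ S → y ∉ S → ¬ Adj G x y) where

  neighbour-of-∉⇒∈ : ∀ {x y} → x ∉ S → Adj G x y → y ∈ S
  neighbour-of-∉⇒∈ {x} {y} x∉S x~y =
    decidable-stable (y ∈? S) (λ y∉S → I-independent x y x∉S y∉S x~y)

legIndex : Fin 5 → Fin 7
legIndex = # 1 ∷ # 2 ∷ # 3 ∷ # 5 ∷ # 6 ∷ []

module TwoStarCover {n} (G : Graph n) (S : Subset n)
  (I-independent : ∀ x y → x ∉ S → y ∉ S → ¬ Adj G x y)
  (f : Fin 7 → Fin n) (f-inj : Injective _≡_ _≡_ f)
  (f-edge : ∀ i j → i ≢ j → T (K13⊔K12 i j) → Adj G (f i) (f j))
  (two-in-S : count (λ i → lookup S (f i)) ≡ 2) where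

  open Split G S I-independent

  no-three-in-S : ∀ i j k → Injective _≡_ _≡_ (i ∷ j ∷ k ∷ []) →
                  f i ∈ S → f j ∈ S → f k ∈ S → ⊥
  no-three-in-S _ _ _ σ-inj i∈S j∈S k∈S = 3≰2 (subst (3 ≤_) two-in-S
    (injective⇒≤count _ _ σ-inj λ { zero → []=⇒lookup i∈S
                                  ; (suc zero) → []=⇒lookup j∈S
                                  ; (suc (suc zero)) → []=⇒lookup k∈S }))
    where
    3≰2 : ¬ 3 ≤ 2
    3≰2 (s≤s (s≤s ()))

  centre₁∈S : f (# 0) ∈ S
  centre₁∈S = decidable-stable (f (# 0) ∈? S) λ a∉S →
    no-three-in-S (# 1) (# 2) (# 3) (decide-injective _)
      (neighbour-of-∉⇒∈ a∉S (f-edge (# 0) (# 1) (λ ()) tt))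
      (neighbour-of-∉⇒∈ a∉S (f-edge (# 0) (# 2) (λ ()) tt))
      (neighbour-of-∉⇒∈ a∉S (f-edge (# 0) (# 3) (λ ()) tt))

  centre₂∈S : f (# 4) ∈ S
  centre₂∈S = decidable-stable (f (# 4) ∈? S) λ b∉S →
    no-three-in-S (# 0) (# 5) (# 6) (decide-injective _)
      centre₁∈S
      (neighbour-of-∉⇒∈ b∉S (f-edge (# 4) (# 5) (λ ()) tt))
      (neighbour-of-∉⇒∈ b∉S (f-edge (# 4) (# 6) (λ ()) tt))

  legs∉S : ∀ l → f (legIndex l) ∉ S
  legs∉S l =
    no-three-in-S (# 0) (# 4) (legIndex l) (centres-and-leg-injective l) centre₁∈S centre₂∈S
    where
    centres-and-leg-injective : ∀ k → Injective _≡_ _≡_ (# 0 ∷ # 4 ∷ legIndex k ∷ [])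
    centres-and-leg-injective = from-yes (all? λ k → injective? (# 0 ∷ # 4 ∷ legIndex k ∷ []))

module LinkedStars {n} (G : Graph n) {a b : Fin n} (legs : Fin 5 → Fin n)
  (legs-inj : Injective _≡_ _≡_ legs) (legs-independent : ∀ k l → ¬ Adj G (legs k) (legs l))
  (b∉legs : ∀ k → b ≢ legs k) (a~b : Adj G a b)
  (a~0 : Adj G a (legs (# 0))) (a~1 : Adj G a (legs (# 1))) (a~2 : Adj G a (legs (# 2)))
  (b~3 : Adj G b (legs (# 3))) (b~4 : Adj G b (legs (# 4))) where

  K14-at-b : ∀ i j → Injective _≡_ _≡_ (i ∷ j ∷ # 3 ∷ # 4 ∷ []) →
             Adj G b (legs i) → Adj G b (legs j) → InducedCopy K14 G
  K14-at-b i j σ-inj b~i b~j = InducedCopy-≗ G K14-as-cone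
    (induced-cone-over-extend G b (legs ∘ (i ∷ j ∷ # 3 ∷ # 4 ∷ [])) _ (σ-inj ∘ legs-inj)
      (λ _ _ → legs-independent _ _) (λ _ → ofⁿ (legs-independent _ _))
      λ { zero → b~i ; (suc zero) → b~j ; (suc (suc zero)) → b~3 ; (suc (suc (suc zero))) → b~4 })

  b∷legs-injective : ∀ {σ : Fin 3 → Fin 5} → Injective _≡_ _≡_ σ →
                     Injective _≡_ _≡_ (b ∷ legs ∘ σ)
  b∷legs-injective σ-inj = injective-∷ (b∉legs ∘ _) (σ-inj ∘ legs-inj)

  K14+e-at-a : ∀ i j k → Injective _≡_ _≡_ (i ∷ j ∷ k ∷ []) →
               Adj G b (legs i) → ¬ Adj G b (legs j) → ¬ Adj G b (legs k) →
               Adj G a (legs i) → Adj G a (legs j) → Adj G a (legs k) → InducedCopy K14+e G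
  K14+e-at-a i j k σ-inj b~i b≁j b≁k a~i a~j a~k = InducedCopy-≗ G K14+e-as-cone
    (induced-cone-over-extend G a (b ∷ legs ∘ (i ∷ j ∷ k ∷ [])) _ (b∷legs-injective σ-inj)
      (λ _ _ → legs-independent _ _)
      (λ { zero → ofʸ b~i ; (suc zero) → ofⁿ b≁j ; (suc (suc zero)) → ofⁿ b≁k })
      λ { zero → a~b ; (suc zero) → a~i ; (suc (suc zero)) → a~j ; (suc (suc (suc zero))) → a~k })

  K14-at-a : ¬ Adj G b (legs (# 0)) → ¬ Adj G b (legs (# 1)) → ¬ Adj G b (legs (# 2)) →
             InducedCopy K14 G
  K14-at-a b≁0 b≁1 b≁2 = InducedCopy-≗ G K14-as-cone
    (induced-cone-over-extend G a (b ∷ legs ∘ (# 0 ∷ # 1 ∷ # 2 ∷ [])) _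
      (b∷legs-injective (decide-injective _))
      (λ _ _ → legs-independent _ _)
      (λ { zero → ofⁿ b≁0 ; (suc zero) → ofⁿ b≁1 ; (suc (suc zero)) → ofⁿ b≁2 })
      λ { zero → a~b ; (suc zero) → a~0 ; (suc (suc zero)) → a~1 ; (suc (suc (suc zero))) → a~2 })

  K14⊎K14+e : InducedCopy K14 G ⊎ InducedCopy K14+e G
  K14⊎K14+e with adj? G b (legs (# 0)) | adj? G b (legs (# 1)) | adj? G b (legs (# 2))
  ... | yes b~0 | yes b~1 | _       = inj₁ (K14-at-b (# 0) (# 1) (decide-injective _) b~0 b~1)
  ... | yes b~0 | no  _   | yes b~2 = inj₁ (K14-at-b (# 0) (# 2) (decide-injective _) b~0 b~2)
  ... | no  _   | yes b~1 | yes b~2 = inj₁ (K14-at-b (# 1) (# 2) (decide-injective _) b~1 b~2)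
  ... | yes b~0 | no  b≁1 | no  b≁2 =
    inj₂ (K14+e-at-a (# 0) (# 1) (# 2) (decide-injective _) b~0 b≁1 b≁2 a~0 a~1 a~2)
  ... | no  b≁0 | yes b~1 | no  b≁2 =
    inj₂ (K14+e-at-a (# 1) (# 0) (# 2) (decide-injective _) b~1 b≁0 b≁2 a~1 a~0 a~2)
  ... | no  b≁0 | no  b≁1 | yes b~2 =
    inj₂ (K14+e-at-a (# 2) (# 0) (# 1) (decide-injective _) b~2 b≁0 b≁1 a~2 a~0 a~1)
  ... | no  b≁0 | no  b≁1 | no  b≁2 = inj₁ (K14-at-a b≁0 b≁1 b≁2)

lemma3p1 : ∀ {n} (G : Graph n) (S : Subset n) →
    Connected G →
    IsSplitPartition G S →
    ¬ InducedCopy K14 G →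
    ¬ InducedCopy K14+e G →
    ¬ (Σ (Fin 7 → Fin n) λ f → IsSubgraphCopy K13⊔K12 G f × count (λ i → lookup S (f i)) ≡ 2)
lemma3p1 G S _ (S-clique , _ , I-independent) K14-free K14+e-free (f , (f-inj , f-edge) , two-in-S) =
  [ K14-free , K14+e-free ] (LinkedStars.K14⊎K14+e G legs legs-inj legs-independent b∉legs a~b
    (f-edge (# 0) (# 1) (λ ()) tt) (f-edge (# 0) (# 2) (λ ()) tt) (f-edge (# 0) (# 3) (λ ()) tt)
    (f-edge (# 4) (# 5) (λ ()) tt) (f-edge (# 4) (# 6) (λ ()) tt))
  where
  open TwoStarCover G S I-independent f f-inj f-edge two-in-S
  legs : Fin 5 → Fin _
  legs = f ∘ legIndex
  legs-inj : Injective _≡_ _≡_ legs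
  legs-inj = decide-injective legIndex ∘ f-inj
  legs-independent : ∀ k l → ¬ Adj G (legs k) (legs l)
  legs-independent k l = I-independent _ _ (legs∉S k) (legs∉S l)
  b∉legs : ∀ k → f (# 4) ≢ legs k
  b∉legs k b≡leg = legs∉S k (subst (_∈ S) b≡leg centre₂∈S)
  a~b : Adj G (f (# 0)) (f (# 4))
  a~b = S-clique _ _ centre₁∈S centre₂∈S (0≢1+n ∘ f-inj)
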